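{- Let $\mathsf{K}$ be an order enriched category and $J$ a subcategory of $\mathsf{K}$ containing all objects of $\mathsf{K}$. The functor $\underline{(-)}:\mathsf{End}_J^{\leq}(\mathsf{K})\to[\mathbb{N},\mathsf{K}]^J$, $\alpha\mapsto(\alpha^n)_{n\in\mathbb{N}}$, $f\mapsto f$, is left 2-adjoint to the functor $(-)_1:[\mathbb{N},\mathsf{K}]^J\to\mathsf{End}_J^{\leq}(\mathsf{K})$, $(\pi_n)_{n\in\mathbb{N}}\mapsto\pi_1$, $f\mapsto f$.
   Context: An order enriched category is a category whose hom-sets are posets with composition monotone in each variable. $\mathsf{End}_J^{\leq}(\mathsf{K})$ is the category whose objects are endomorphisms $\alpha:X\to X$ of $\mathsf{K}$; a morphism from $\alpha:X\to X$ to $\beta:Y\to Y$ is an arrow $f:X\to Y$ of $J$ with $f\circ\alpha\leq\beta\circ f$; hom-sets are ordered by the order of $\mathsf{K}$. $[\mathbb{N},\mathsf{K}]^J$ is the category of lax functors from the one-object category of the monoid $(\mathbb{N},+,0)$ to $\mathsf{K}$ with oplax transformations having components in $J$: an object is a family $(\pi_n)_{n\in\mathbb{N}}$ of endomorphisms of a common object $X$ with $id_X\leq\pi_0$ and $\pi_m\circ\pi_n\leq\pi_{m+n}$; a morphism $\pi\to\pi'$ is an arrow $f$ of $J$ between the carriers with $f\circ\pi_n\leq\pi'_n\circ f$ for all $n$; order inherited from $\mathsf{K}$. A 2-adjunction between order enriched categories is a pair of locally monotonic (hom-order preserving) functors $F:\mathsf{A}\to\mathsf{B}$, $U:\mathsf{B}\to\mathsf{A}$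 together with isomorphisms of posets $\mathsf{B}(FX,Y)\cong\mathsf{A}(X,UY)$ natural in $X$ and $Y$; $F$ is the left 2-adjoint. -}

module Defs where

open import Level using (Level; _⊔_) renaming (suc to lsuc)
open import Data.Nat using (ℕ; zero; suc; _+_)
open import Data.Product using (Σ; _×_; _,_; proj₁; proj₂)
open import Relation.Binary.Structures using (IsPartialOrder; IsPreorder; IsEquivalence)
import Relation.Binary.Construct.On as On

record OrderCat (o h r : Level) : Set (lsuc (o ⊔ h ⊔ r)) where
  infixr 9 _∘_
  infix 4 _≈_ _≤_
  field
    Obj : Set o
    Hom : Obj → Obj → Set h
    _≈_ : ∀ {X Y} → Hom X Y → Hom X Y → Set r
    _≤_ : ∀ {X Y} → Hom X Y → Hom X Y → Set r
    id  : ∀ {X} → Hom X X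
    _∘_ : ∀ {X Y Z} → Hom Y Z → Hom X Y → Hom X Z
    isPartialOrder : ∀ {X Y} → IsPartialOrder (_≈_ {X} {Y}) _≤_
    identityˡ : ∀ {X Y} {f : Hom X Y} → id ∘ f ≈ f
    identityʳ : ∀ {X Y} {f : Hom X Y} → f ∘ id ≈ f
    assoc : ∀ {W X Y Z} {f : Hom W X} {g : Hom X Y} {k : Hom Y Z} →
            (k ∘ g) ∘ f ≈ k ∘ (g ∘ f)
    ∘-mono : ∀ {X Y Z} {g g' : Hom Y Z} {f f' : Hom X Y} →
             g ≤ g' → f ≤ f' → g ∘ f ≤ g' ∘ f'

-- A subcategory J of K containing all objects of K (a wide subcategory),
-- given as a predicate on arrows closed under identities and composition
-- (and invariant under the equality of arrows).
record WideSub {o h r : Level} (K : OrderCat o h r) (j : Level) : Set (o ⊔ h ⊔ r ⊔ lsuc j) where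
  open OrderCat K
  field
    InJ  : ∀ {X Y} → Hom X Y → Set j
    id-J : ∀ {X} → InJ (id {X})
    ∘-J  : ∀ {X Y Z} {g : Hom Y Z} {f : Hom X Y} → InJ g → InJ f → InJ (g ∘ f)
    resp-J : ∀ {X Y} {f g : Hom X Y} → f ≈ g → InJ f → InJ g

record LMFunctor {o h r o' h' r' : Level} (A : OrderCat o h r) (B : OrderCat o' h' r')
       : Set (o ⊔ h ⊔ r ⊔ o' ⊔ h' ⊔ r') where
  private
    module A = OrderCat A
    module B = OrderCat B
  field
    F₀ : A.Obj → B.Obj
    F₁ : ∀ {X Y} → A.Hom X Y → B.Hom (F₀ X) (F₀ Y)
    F-resp-≈ : ∀ {X Y} {f g : A.Hom X Y} → f A.≈ g → F₁ f B.≈ F₁ g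
    F-id : ∀ {X} → F₁ (A.id {X}) B.≈ B.id
    F-∘  : ∀ {X Y Z} {g : A.Hom Y Z} {f : A.Hom X Y} → F₁ (g A.∘ f) B.≈ F₁ g B.∘ F₁ f
    F-mono : ∀ {X Y} {f g : A.Hom X Y} → f A.≤ g → F₁ f B.≤ F₁ g

record TwoAdjunction {o h r o' h' r' : Level} {A : OrderCat o h r} {B : OrderCat o' h' r'}
       (F : LMFunctor A B) (U : LMFunctor B A) : Set (o ⊔ h ⊔ r ⊔ o' ⊔ h' ⊔ r') where
  private
    module A = OrderCat A
    module B = OrderCat B
    module F = LMFunctor F
    module U = LMFunctor U
  field
    φ : ∀ {X Y} → B.Hom (F.F₀ X) Y → A.Hom X (U.F₀ Y)
    ψ : ∀ {X Y} → A.Hom X (U.F₀ Y) → B.Hom (F.F₀ X) Y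
    φ-resp-≈ : ∀ {X Y} {g g' : B.Hom (F.F₀ X) Y} → g B.≈ g' → φ g A.≈ φ g'
    ψ-resp-≈ : ∀ {X Y} {f f' : A.Hom X (U.F₀ Y)} → f A.≈ f' → ψ f B.≈ ψ f'
    φ-mono : ∀ {X Y} {g g' : B.Hom (F.F₀ X) Y} → g B.≤ g' → φ g A.≤ φ g'
    ψ-mono : ∀ {X Y} {f f' : A.Hom X (U.F₀ Y)} → f A.≤ f' → ψ f B.≤ ψ f'
    ψφ : ∀ {X Y} {g : B.Hom (F.F₀ X) Y} → ψ (φ g) B.≈ g
    φψ : ∀ {X Y} {f : A.Hom X (U.F₀ Y)} → φ (ψ f) A.≈ f
    natural : ∀ {X X' Y Y'} (a : A.Hom X' X) (g : B.Hom (F.F₀ X) Y) (b : B.Hom Y Y') →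
              φ (b B.∘ (g B.∘ F.F₁ a)) A.≈ U.F₁ b A.∘ (φ g A.∘ a)

module Constructions {o h r j : Level} (K : OrderCat o h r) (J : WideSub K j) where
  open OrderCat K
  open WideSub J

  private
    module PO {X Y} = IsPartialOrder (isPartialOrder {X} {Y})
    ≤-refl : ∀ {X Y} {f : Hom X Y} → f ≤ f
    ≤-refl = PO.reflexive PO.Eq.refl
    ≈⇒≤ : ∀ {X Y} {f g : Hom X Y} → f ≈ g → f ≤ g
    ≈⇒≤ = PO.reflexive
    ≈⇒≥ : ∀ {X Y} {f g : Hom X Y} → f ≈ g → g ≤ f
    ≈⇒≥ e = PO.reflexive (PO.Eq.sym e)
    _⨾_ : ∀ {X Y} {f g k : Hom X Y} → f ≤ g → g ≤ k → f ≤ k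
    _⨾_ = PO.trans
    ∘-resp-≈ : ∀ {X Y Z} {g g' : Hom Y Z} {f f' : Hom X Y} → g ≈ g' → f ≈ f' → g ∘ f ≈ g' ∘ f'
    ∘-resp-≈ eg ef = PO.antisym (∘-mono (≈⇒≤ eg) (≈⇒≤ ef)) (∘-mono (≈⇒≥ eg) (≈⇒≥ ef))

  pow : ∀ {X} → ℕ → Hom X X → Hom X X
  pow zero    α = id
  pow (suc n) α = α ∘ pow n α

  EndObj : Set (o ⊔ h)
  EndObj = Σ Obj (λ X → Hom X X)

  EndHom : EndObj → EndObj → Set (h ⊔ r ⊔ j)
  EndHom (X , α) (Y , β) = Σ (Hom X Y) (λ f → InJ f × (f ∘ α ≤ β ∘ f))

  End : OrderCat (o ⊔ h) (h ⊔ r ⊔ j) r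
  End = record
    { Obj = EndObj
    ; Hom = EndHom
    ; _≈_ = λ f g → proj₁ f ≈ proj₁ g
    ; _≤_ = λ f g → proj₁ f ≤ proj₁ g
    ; id = λ {A} → id , id-J , (≈⇒≤ identityˡ ⨾ ≈⇒≥ identityʳ)
    ; _∘_ = λ { (g , gJ , gm) (f , fJ , fm) → g ∘ f , ∘-J gJ fJ ,
               (≈⇒≤ assoc ⨾ (∘-mono ≤-refl fm ⨾ (≈⇒≥ assoc ⨾
               (∘-mono gm ≤-refl ⨾ ≈⇒≤ assoc)))) }
    ; isPartialOrder = On.isPartialOrder proj₁ isPartialOrder
    ; identityˡ = identityˡ
    ; identityʳ = identityʳ
    ; assoc = assoc
    ; ∘-mono = ∘-mono
    }

  -- [ℕ, K]^J : lax functors ℕ → K with oplax transformations with components in J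
  LaxObj : Set (o ⊔ h ⊔ r)
  LaxObj = Σ Obj (λ X → Σ (ℕ → Hom X X) (λ π →
             (id ≤ π 0) × (∀ m n → π m ∘ π n ≤ π (m + n))))

  carrier : LaxObj → Obj
  carrier = proj₁

  comp : (P : LaxObj) → ℕ → Hom (carrier P) (carrier P)
  comp P = proj₁ (proj₂ P)

  LaxHom : LaxObj → LaxObj → Set (h ⊔ r ⊔ j)
  LaxHom P Q = Σ (Hom (carrier P) (carrier Q)) (λ f →
                 InJ f × (∀ n → f ∘ comp P n ≤ comp Q n ∘ f))

  Lax : OrderCat (o ⊔ h ⊔ r) (h ⊔ r ⊔ j) r
  Lax = record
    { Obj = LaxObj
    ; Hom = LaxHom
    ; _≈_ = λ f g → proj₁ f ≈ proj₁ g
    ; _≤_ = λ f g → proj₁ f ≤ proj₁ g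
    ; id = id , id-J , (λ n → ≈⇒≤ identityˡ ⨾ ≈⇒≥ identityʳ)
    ; _∘_ = λ { (g , gJ , gm) (f , fJ , fm) → g ∘ f , ∘-J gJ fJ ,
               (λ n → ≈⇒≤ assoc ⨾ (∘-mono ≤-refl (fm n) ⨾ (≈⇒≥ assoc ⨾
               (∘-mono (gm n) ≤-refl ⨾ ≈⇒≤ assoc)))) }
    ; isPartialOrder = On.isPartialOrder proj₁ isPartialOrder
    ; identityˡ = identityˡ
    ; identityʳ = identityʳ
    ; assoc = assoc
    ; ∘-mono = ∘-mono
    }

  pow-+ : ∀ {X} (α : Hom X X) m n → pow m α ∘ pow n α ≈ pow (m + n) α
  pow-+ α zero n = identityˡ
  pow-+ α (suc m) n = PO.Eq.trans assoc (∘-resp-≈ PO.Eq.refl (pow-+ α m n))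

  pow-mor : ∀ {X Y} {α : Hom X X} {β : Hom Y Y} {f : Hom X Y} →
            f ∘ α ≤ β ∘ f → ∀ n → f ∘ pow n α ≤ pow n β ∘ f
  pow-mor fm zero = ≈⇒≤ identityʳ ⨾ ≈⇒≥ identityˡ
  pow-mor fm (suc n) =
    ≈⇒≥ assoc ⨾ (∘-mono fm ≤-refl ⨾ (≈⇒≤ assoc ⨾
    (∘-mono ≤-refl (pow-mor fm n) ⨾ ≈⇒≥ assoc)))

  Powers : LMFunctor End Lax
  Powers = record
    { F₀ = λ { (X , α) → X , (λ n → pow n α) , ≤-refl , (λ m n → ≈⇒≤ (pow-+ α m n)) }
    ; F₁ = λ { (f , fJ , fm) → f , fJ , pow-mor fm }
    ; F-resp-≈ = λ e → e
    ; F-id = PO.Eq.refl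
    ; F-∘ = PO.Eq.refl
    ; F-mono = λ p → p
    }

  First : LMFunctor Lax End
  First = record
    { F₀ = λ P → carrier P , comp P 1
    ; F₁ = λ { (f , fJ , fm) → f , fJ , fm 1 }
    ; F-resp-≈ = λ e → e
    ; F-id = PO.Eq.refl
    ; F-∘ = PO.Eq.refl
    ; F-mono = λ p → p
    }

module Submission where

-- A morphism (α^n)_n → (π_n)_n in [ℕ, K]^J is an arrow f of J
-- with f ∘ α^n ≤ π_n ∘ f for every n; a morphism α → π_1 in End_J^≤(K) is an
-- arrow f of J with f ∘ α ≤ π_1 ∘ f.  Both hom-posets are ordered by the
-- underlying arrows, so the adjunction bijection is the identity on arrows
-- and it only remains to see that the two conditions on f are equivalent.
--   * The n = 1 instance of the first gives the second, since α^1 = α ∘ id.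
--   * Conversely, f ∘ α ≤ π_1 ∘ f gives f ∘ α^n ≤ π_1^n ∘ f (pow-mor, from
--     the definitions), and every lax functor satisfies π_1^n ≤ π_n, by
--     induction from id ≤ π_0 and π_1 ∘ π_n ≤ π_(1+n).
-- Since φ and ψ act as the identity on underlying arrows, all the equations
-- and monotonicity conditions of a 2-adjunction hold trivially.

open import Level using (Level)
open import Data.Nat using (zero; suc; _+_)
open import Data.Product using (_,_; proj₁; proj₂)
open import Relation.Binary.Bundles using (Poset)
import Relation.Binary.Reasoning.PartialOrder as PosetReasoning
open import Defs

module PowersFirstAdjunction {o h r j : Level} (K : OrderCat o h r) (J : WideSub K j) where
  open OrderCat K
  open Constructions K J

  homPoset : Obj → Obj → Poset h r r
  homPoset X Y = record { isPartialOrder = isPartialOrder {X} {Y} }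

  module Hom {X Y : Obj} = Poset (homPoset X Y)
  open module HomReasoning {X Y : Obj} = PosetReasoning (homPoset X Y)

  ∘-resp-≈ʳ : ∀ {X Y Z} (f : Hom Y Z) {g g' : Hom X Y} → g ≈ g' → f ∘ g ≈ f ∘ g'
  ∘-resp-≈ʳ f e = Hom.antisym (∘-mono Hom.refl (Hom.reflexive e))
                              (∘-mono Hom.refl (Hom.reflexive (Hom.Eq.sym e)))

  unit-lax : (P : LaxObj) → id ≤ comp P 0
  unit-lax P = proj₁ (proj₂ (proj₂ P))

  mult-lax : (P : LaxObj) → ∀ m n → comp P m ∘ comp P n ≤ comp P (m + n)
  mult-lax P = proj₂ (proj₂ (proj₂ P))

  -- In a lax functor the n-th component dominates the n-th power of the
  -- first one; this is what lets (α^n)_n be the free lax functor on α.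
  pow-first≤comp : (P : LaxObj) → ∀ n → pow n (comp P 1) ≤ comp P n
  pow-first≤comp P zero    = unit-lax P
  pow-first≤comp P (suc n) = begin
    comp P 1 ∘ pow n (comp P 1) ≤⟨ ∘-mono Hom.refl (pow-first≤comp P n) ⟩
    comp P 1 ∘ comp P n         ≤⟨ mult-lax P 1 n ⟩
    comp P (suc n)              ∎

  extend : ∀ {X} {α : Hom X X} (P : LaxObj) {f : Hom X (carrier P)} →
           f ∘ α ≤ comp P 1 ∘ f → ∀ n → f ∘ pow n α ≤ comp P n ∘ f
  extend {α = α} P {f} fα≤π₁f n = begin
    f ∘ pow n α            ≤⟨ pow-mor fα≤π₁f n ⟩
    pow n (comp P 1) ∘ f   ≤⟨ ∘-mono (pow-first≤comp P n) Hom.refl ⟩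
    comp P n ∘ f           ∎

  restrict : ∀ {X Y} {α : Hom X X} {π₁ : Hom Y Y} {f : Hom X Y} →
             f ∘ pow 1 α ≤ π₁ ∘ f → f ∘ α ≤ π₁ ∘ f
  restrict {α = α} {π₁} {f} fα¹≤π₁f = begin
    f ∘ α        ≈⟨ ∘-resp-≈ʳ f (Hom.Eq.sym identityʳ) ⟩
    f ∘ pow 1 α  ≤⟨ fα¹≤π₁f ⟩
    π₁ ∘ f       ∎

  adjunction : TwoAdjunction Powers First
  adjunction = record
    { φ        = λ { (f , f∈J , f-lax) → f , f∈J , restrict (f-lax 1) }
    ; ψ        = λ { {Y = P} (f , f∈J , f-lax) → f , f∈J , extend P f-lax }
    ; φ-resp-≈ = λ e → e
    ; ψ-resp-≈ = λ e → e
    ; φ-mono   = λ p → p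
    ; ψ-mono   = λ p → p
    ; ψφ       = Hom.Eq.refl
    ; φψ       = Hom.Eq.refl
    ; natural  = λ _ _ _ → Hom.Eq.refl
    }

proposition3p5 : {o h r j : Level} (K : OrderCat o h r) (J : WideSub K j) →
    TwoAdjunction (Constructions.Powers K J) (Constructions.First K J)
proposition3p5 K J = PowersFirstAdjunction.adjunction K J
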